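{- Let $n,N$ be positive integers and $p$ a prime with $p\mid N$. Then \[ Z_n(N,p)=\frac{n!}{N}\sum_{\substack{1\le u_1<\dots<u_{n-1}<N \\ u_1,\,u_2-u_1,\,\dots,\,u_{n-1}-u_{n-2},\,u_{n-1}\in \mathcal{P}_p }} \frac{1}{u_1\cdots u_{n-1}}. \]
   Context: $\mathcal{P}_p$ denotes the set of positive integers not divisible by $p$. For $p\mid N$, $Z_n(N,p):=\sum \frac{1}{l_1 l_2\cdots l_n}$, the sum over all $n$-tuples $(l_1,\dots,l_n)$ of elements of $\mathcal{P}_p$ with $l_1+\dots+l_n=N$. -}

module Defs where

open import Data.Nat using (ℕ; zero; suc; _∸_; _!; _≤?_)
open import Data.Nat.Divisibility using (_∣_; _∣?_)
open import Data.Integer using (+_)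
open import Data.Rational using (ℚ; 0ℚ; 1ℚ; _+_; _*_; _/_)
open import Data.List using (List; []; _∷_; map; concatMap; filter; foldr)
open import Data.List.Relation.Unary.All using (All; all?)
open import Relation.Nullary using (¬_; Dec; yes; no)
open import Data.Product using (_×_)
open import Relation.Nullary.Decidable using (_×-dec_; ¬?)

-- Membership in 𝒫_p : positive integers not divisible by p.
InP : ℕ → ℕ → Set
InP p l = ¬ (p ∣ l)

inP? : (p l : ℕ) → Dec (InP p l)
inP? p l = ¬? (p ∣? l)

recip : ℕ → ℚ
recip zero    = 0ℚ
recip (suc k) = (+ 1) / suc k

fromℕℚ : ℕ → ℚ
fromℕℚ n = (+ n) / 1

sumℚ : List ℚ → ℚ
sumℚ = foldr _+_ 0ℚ

sumRecipProd : List (List ℕ) → ℚ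
sumRecipProd ts = sumℚ (map (λ t → foldr (λ x r → recip x * r) 1ℚ t) ts)

from : ℕ → ℕ → List ℕ
from a zero    = []
from a (suc k) = a ∷ from (suc a) k

compositions : ℕ → ℕ → List (List ℕ)
compositions zero zero    = [] ∷ []
compositions zero (suc _) = []
compositions (suc n) N =
  concatMap (λ l → map (l ∷_) (compositions n (N ∸ l))) (from 1 N)

Z : ℕ → ℕ → ℕ → ℚ
Z n N p = sumRecipProd (filter (λ t → all? (inP? p) t) (compositions n N))

incSeqs : ℕ → ℕ → ℕ → List (List ℕ)
incSeqs zero    lo hi = [] ∷ []
incSeqs (suc k) lo hi =
  concatMap (λ u → map (u ∷_) (incSeqs k (suc u) hi)) (from lo (hi ∸ lo))

gaps : ℕ → List ℕ → List ℕ
gaps prev []       = []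
gaps prev (u ∷ us) = (u ∸ prev) ∷ gaps u us

-- last element, with u₀ = 0 for the empty tuple
lastOr0 : List ℕ → ℕ
lastOr0 []           = 0
lastOr0 (u ∷ [])     = u
lastOr0 (_ ∷ v ∷ us) = lastOr0 (v ∷ us)

Good : ℕ → List ℕ → Set
Good p us = All (InP p) (gaps 0 us) × InP p (lastOr0 us)

good? : (p : ℕ) (us : List ℕ) → Dec (Good p us)
good? p us = all? (inP? p) (gaps 0 us) ×-dec inP? p (lastOr0 us)

RHS : ℕ → ℕ → ℕ → ℚ
RHS n N p =
  fromℕℚ (n !) * recip N
    * sumRecipProd (filter (good? p) (incSeqs (n ∸ 1) 1 N))

module Submission where

open import Defs
open import Data.Nat using (ℕ; _≤_)
open import Data.Nat.Divisibility using (_∣_)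
open import Data.Nat.Primality using (Prime)
open import Relation.Binary.PropositionalEquality using (_≡_)

open import Data.Bool using (Bool; true; false; _∧_)
open import Data.Bool.Properties using (∧-assoc)
open import Data.Nat as ℕ using (zero; suc; _<_; _∸_; z≤n; s≤s; _!)
import Data.Nat.Properties as ℕP
open import Data.Nat.Divisibility using (_∣?_; ∣m+n∣m⇒∣n; _∣0)
open import Data.Nat.Coprimality using (1-coprimeTo) renaming (sym to coprime-sym)
import Data.Integer as ℤ
import Data.Integer.Properties as ℤP
open import Data.Integer.Solver using () renaming (module +-*-Solver to ℤ-Solver)
open import Data.Rational using (ℚ; 0ℚ; 1ℚ; _+_; _*_; mkℚ; toℚᵘ)
open import Data.Rational.Properties
  using (+-assoc; +-comm; +-identityˡ; +-identityʳ; *-comm; *-assoc; *-zeroˡ; *-zeroʳ;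
         *-identityˡ; *-identityʳ; *-distribˡ-+; normalize-coprime; *-inverseʳ;
         toℚᵘ-injective; toℚᵘ-homo-+;
         +-0-commutativeMonoid; *-1-commutativeMonoid)
open import Data.Rational.Solver using () renaming (module +-*-Solver to ℚ-Solver)
open import Algebra.Bundles using (CommutativeMonoid)
open import Algebra.Properties.CommutativeSemigroup (CommutativeMonoid.commutativeSemigroup +-0-commutativeMonoid)
  using () renaming (interchange to +-interchange)
open import Algebra.Properties.CommutativeSemigroup (CommutativeMonoid.commutativeSemigroup *-1-commutativeMonoid)
  using () renaming (x∙yz≈y∙xz to *-leftComm; x∙yz≈z∙yx to *-reverse3; x∙yz≈yx∙z to *-leftComm-assoc)
import Data.Rational.Unnormalised as ℚᵘ
import Data.Rational.Unnormalised.Properties as ℚᵘP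
open import Data.List using (List; []; _∷_; map; concatMap; filter; foldr; _++_)
open import Data.List.Relation.Unary.All using (All; all?)
open import Data.Product using (_×_)
open import Data.Empty using (⊥-elim)
open import Relation.Nullary using (yes; no; does)
open import Relation.Nullary.Decidable using (_×-dec_)
open import Relation.Unary using (Decidable)
open import Relation.Binary.PropositionalEquality
  using (refl; sym; trans; cong; cong₂; subst; module ≡-Reasoning)
open ≡-Reasoning

-- Write c(l) for the indicator of l ∈ 𝒫_p (so c(0) = 0 since p ∣ 0) and let
--   comp n N = Σ_{l₁+⋯+lₙ = N} ∏ c(lⱼ)/lⱼ,   i.e.  comp (n+1) = w ⋆ comp n,
-- an n-fold convolution power of w(l) = c(l)/l; so Z n N p = comp n N.
-- Multiplying a convolution by its total degree obeys a Leibniz rule,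
--   N·(f ⋆ g)(N) = ((l·f) ⋆ g)(N) + (f ⋆ (l·g))(N),
-- and since l·w(l) = c(l) and convolution factors commute, induction on n
-- gives the symmetrisation identity  N·comp(n+1)(N) = (n+1)·(c ⋆ comp n)(N).
-- Peeling off the largest part repeatedly then turns this into
--   N·comp(n+1)(N) = (n+1)!·chain n 0 N,
-- where chain k s e sums ∏ c(gaps)/(u₁⋯u_k) over s < u₁ < ⋯ < u_k < e; the
-- key fact is that chain, defined by recursion on its smallest point, also
-- satisfies the recursion on its largest point.  Finally the list-level sums
-- of the statement are identified with comp and chain, the condition
-- e − u_k ∈ 𝒫_p being equivalent to u_k ∈ 𝒫_p because p ∣ N.

ι : ℕ → ℚ
ι = fromℕℚ

ιⁿᶠ : ℕ → ℚ
ιⁿᶠ n = mkℚ (ℤ.+ n) 0 (coprime-sym (1-coprimeTo n))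

ι-normal : ∀ n → ι n ≡ ιⁿᶠ n
ι-normal n = normalize-coprime (coprime-sym (1-coprimeTo n))

ι-+ : ∀ m n → ι (m ℕ.+ n) ≡ ι m + ι n
ι-+ m n rewrite ι-normal (m ℕ.+ n) | ι-normal m | ι-normal n =
  toℚᵘ-injective
    (ℚᵘP.≃-trans (ℚᵘ.*≡* (trans (cong (ℤ._* ℤ.+ 1) (ℤP.pos-+ m n)) (denominators (ℤ.+ m) (ℤ.+ n))))
                 (ℚᵘP.≃-sym (toℚᵘ-homo-+ (ιⁿᶠ m) (ιⁿᶠ n))))
  where
  open ℤ-Solver
  denominators : ∀ x y → (x ℤ.+ y) ℤ.* ℤ.+ 1 ≡ (x ℤ.* ℤ.+ 1 ℤ.+ y ℤ.* ℤ.+ 1) ℤ.* ℤ.+ 1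
  denominators = solve 2 (λ x y → (x :+ y) :* con (ℤ.+ 1) := (x :* con (ℤ.+ 1) :+ y :* con (ℤ.+ 1)) :* con (ℤ.+ 1)) refl

ι-suc-* : ∀ n x → x + ι n * x ≡ ι (suc n) * x
ι-suc-* n x = begin
  x + ι n * x        ≡⟨ ℚ-Solver.solve 2 (λ x y → x :+ y :* x := (con 1ℚ :+ y) :* x) refl x (ι n) ⟩
  (1ℚ + ι n) * x     ≡⟨ cong (_* x) (sym (ι-+ 1 n)) ⟩
  ι (suc n) * x      ∎
  where open ℚ-Solver

ι-* : ∀ m n → ι (m ℕ.* n) ≡ ι m * ι n
ι-* zero    n = sym (*-zeroˡ (ι n))
ι-* (suc m) n = begin
  ι (n ℕ.+ m ℕ.* n)   ≡⟨ ι-+ n (m ℕ.* n) ⟩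
  ι n + ι (m ℕ.* n)   ≡⟨ cong (ι n +_) (ι-* m n) ⟩
  ι n + ι m * ι n     ≡⟨ ι-suc-* m (ι n) ⟩
  ι (suc m) * ι n     ∎

ι*recip : ∀ k → ι (suc k) * recip (suc k) ≡ 1ℚ
ι*recip k rewrite ι-normal (suc k) | normalize-coprime (1-coprimeTo (suc k)) =
  *-inverseʳ (ιⁿᶠ (suc k))

deg : (ℕ → ℚ) → ℕ → ℚ
deg g v = ι v * g v

-- A sequence vanishing at 0 is recovered from its degree (recip 0 = 0).
recip-deg : ∀ g → g 0 ≡ 0ℚ → ∀ v → g v ≡ recip v * deg g v
recip-deg g g0 zero    = trans g0 (sym (*-zeroˡ (deg g 0)))
recip-deg g g0 (suc v) = begin
  g (suc v)                                 ≡⟨ sym (*-identityˡ (g (suc v))) ⟩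
  1ℚ * g (suc v)                            ≡⟨ cong (_* g (suc v)) (sym (trans (*-comm (recip (suc v)) (ι (suc v))) (ι*recip v))) ⟩
  (recip (suc v) * ι (suc v)) * g (suc v)   ≡⟨ *-assoc (recip (suc v)) (ι (suc v)) (g (suc v)) ⟩
  recip (suc v) * deg g (suc v)             ∎

ind : Bool → ℚ
ind true  = 1ℚ
ind false = 0ℚ

ind-∧ : ∀ a b → ind (a ∧ b) ≡ ind a * ind b
ind-∧ true  b = sym (*-identityˡ (ind b))
ind-∧ false b = sym (*-zeroˡ (ind b))

χ : ℕ → ℕ → ℚ
χ p l = ind (does (inP? p l))

χ-zero : ∀ p → χ p 0 ≡ 0ℚ
χ-zero p with p ∣? 0
... | yes _    = refl
... | no  p∤0  = ⊥-elim (p∤0 (p ∣0))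

-- For p ∣ N, s ∈ 𝒫_p iff N − s ∈ 𝒫_p: this turns the paper's last
-- condition u_{n-1} ∈ 𝒫_p into the gap condition N − u_{n-1} ∈ 𝒫_p.
χ-complement : ∀ p {N s} → p ∣ N → s ≤ N → χ p s ≡ χ p (N ∸ s)
χ-complement p {N} {s} p∣N s≤N with p ∣? s | p ∣? (N ∸ s)
... | yes _   | yes _   = refl
... | no  _   | no  _   = refl
... | yes p∣s | no  p∤r = ⊥-elim (p∤r (∣m+n∣m⇒∣n (subst (p ∣_) (sym (ℕP.m+[n∸m]≡n s≤N)) p∣N) p∣s))
... | no  p∤s | yes p∣r = ⊥-elim (p∤s (∣m+n∣m⇒∣n (subst (p ∣_) (sym (ℕP.m∸n+n≡m s≤N)) p∣N) p∣r))

∑ : ℕ → (ℕ → ℚ) → ℚ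
∑ zero    f = 0ℚ
∑ (suc k) f = f 0 + ∑ k (λ i → f (suc i))

∑-cong : ∀ k {f g : ℕ → ℚ} → (∀ i → i < k → f i ≡ g i) → ∑ k f ≡ ∑ k g
∑-cong zero    f≡g = refl
∑-cong (suc k) f≡g = cong₂ _+_ (f≡g 0 (s≤s z≤n)) (∑-cong k (λ i i<k → f≡g (suc i) (s≤s i<k)))

∑-zero : ∀ k f → (∀ i → i < k → f i ≡ 0ℚ) → ∑ k f ≡ 0ℚ
∑-zero zero    f f≡0 = refl
∑-zero (suc k) f f≡0 =
  trans (cong₂ _+_ (f≡0 0 (s≤s z≤n)) (∑-zero k (λ i → f (suc i)) (λ i i<k → f≡0 (suc i) (s≤s i<k))))
        (+-identityˡ 0ℚ)

∑-snoc : ∀ k f → ∑ (suc k) f ≡ ∑ k f + f k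
∑-snoc zero    f = trans (+-identityʳ (f 0)) (sym (+-identityˡ (f 0)))
∑-snoc (suc k) f = trans (cong (f 0 +_) (∑-snoc k (λ i → f (suc i)))) (sym (+-assoc (f 0) _ _))

∑-+ : ∀ k f g → ∑ k (λ i → f i + g i) ≡ ∑ k f + ∑ k g
∑-+ zero    f g = sym (+-identityˡ 0ℚ)
∑-+ (suc k) f g = trans (cong ((f 0 + g 0) +_) (∑-+ k (λ i → f (suc i)) (λ i → g (suc i))))
                        (+-interchange (f 0) (g 0) _ _)

∑-*ˡ : ∀ k c f → ∑ k (λ i → c * f i) ≡ c * ∑ k f
∑-*ˡ zero    c f = sym (*-zeroʳ c)
∑-*ˡ (suc k) c f = trans (cong (c * f 0 +_) (∑-*ˡ k c (λ i → f (suc i)))) (sym (*-distribˡ-+ c _ _))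

∑-comm : ∀ m n (F : ℕ → ℕ → ℚ) → ∑ m (λ i → ∑ n (F i)) ≡ ∑ n (λ j → ∑ m (λ i → F i j))
∑-comm zero    n F = sym (∑-zero n (λ _ → 0ℚ) (λ _ _ → refl))
∑-comm (suc m) n F = begin
  ∑ n (F 0) + ∑ m (λ i → ∑ n (F (suc i)))             ≡⟨ cong (∑ n (F 0) +_) (∑-comm m n (λ i → F (suc i))) ⟩
  ∑ n (F 0) + ∑ n (λ j → ∑ m (λ i → F (suc i) j))     ≡⟨ sym (∑-+ n (F 0) _) ⟩
  ∑ n (λ j → ∑ (suc m) (λ i → F i j))                 ∎

suc-∸ : ∀ {i k} → i < k → k ∸ i ≡ suc (k ∸ suc i)
suc-∸ i<k = ℕP.+-∸-assoc 1 i<k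

reflect-index : ∀ {N j} → j < N → N ∸ suc (N ∸ suc j) ≡ j
reflect-index {suc N} (s≤s j≤N) = ℕP.m∸[m∸n]≡n j≤N

∑-reverse : ∀ k f → ∑ k f ≡ ∑ k (λ i → f (k ∸ suc i))
∑-reverse zero    f = refl
∑-reverse (suc k) f = begin
  f 0 + ∑ k (λ i → f (suc i))                  ≡⟨ cong (f 0 +_) (∑-reverse k (λ i → f (suc i))) ⟩
  f 0 + ∑ k (λ i → f (suc (k ∸ suc i)))        ≡⟨ +-comm (f 0) _ ⟩
  ∑ k (λ i → f (suc (k ∸ suc i))) + f 0        ≡⟨ cong₂ _+_ (∑-cong k (λ i i<k → cong f (sym (suc-∸ i<k))))
                                                            (cong f (sym (ℕP.n∸n≡0 k))) ⟩
  ∑ k (λ i → f (k ∸ i)) + f (k ∸ k)            ≡⟨ sym (∑-snoc k (λ i → f (k ∸ i))) ⟩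
  ∑ (suc k) (λ i → f (k ∸ i))                  ∎

∑-vanishing-tail : ∀ n d f → (∀ j → f (n ℕ.+ j) ≡ 0ℚ) → ∑ (n ℕ.+ d) f ≡ ∑ n f
∑-vanishing-tail zero    d f tail≡0 = ∑-zero d f (λ j _ → tail≡0 j)
∑-vanishing-tail (suc n) d f tail≡0 = cong (f 0 +_) (∑-vanishing-tail n d (λ i → f (suc i)) tail≡0)

∑-vanishing-prefix : ∀ m N f → (∀ u → u < m → f u ≡ 0ℚ) → ∑ N f ≡ ∑ (N ∸ m) (λ i → f (m ℕ.+ i))
∑-vanishing-prefix zero    N       f prefix≡0 = refl
∑-vanishing-prefix (suc m) zero    f prefix≡0 = refl
∑-vanishing-prefix (suc m) (suc N) f prefix≡0 = begin
  f 0 + ∑ N (λ i → f (suc i))                ≡⟨ cong (_+ ∑ N (λ i → f (suc i))) (prefix≡0 0 (s≤s z≤n)) ⟩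
  0ℚ + ∑ N (λ i → f (suc i))                 ≡⟨ +-identityˡ _ ⟩
  ∑ N (λ i → f (suc i))                      ≡⟨ ∑-vanishing-prefix m N (λ i → f (suc i)) (λ u u<m → prefix≡0 (suc u) (s≤s u<m)) ⟩
  ∑ (N ∸ m) (λ i → f (suc m ℕ.+ i))          ∎

-- Row i of the triangle {i + j < N+1} has length N − i; splitting off
-- the last entry of each row separates the anti-diagonal i + j = N − 1.
∑-peel-antidiagonal : ∀ N (G : ℕ → ℕ → ℚ) →
  ∑ (suc N) (λ i → ∑ (N ∸ i) (G i)) ≡ ∑ N (λ i → ∑ (N ∸ suc i) (G i)) + ∑ N (λ i → G i (N ∸ suc i))
∑-peel-antidiagonal N G = begin
  ∑ (suc N) (λ i → ∑ (N ∸ i) (G i))                                  ≡⟨ ∑-snoc N _ ⟩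
  ∑ N (λ i → ∑ (N ∸ i) (G i)) + ∑ (N ∸ N) (G N)                      ≡⟨ cong₂ _+_ (∑-cong N split-row) (cong (λ m → ∑ m (G N)) (ℕP.n∸n≡0 N)) ⟩
  ∑ N (λ i → ∑ (N ∸ suc i) (G i) + G i (N ∸ suc i)) + 0ℚ             ≡⟨ +-identityʳ _ ⟩
  ∑ N (λ i → ∑ (N ∸ suc i) (G i) + G i (N ∸ suc i))                  ≡⟨ ∑-+ N _ _ ⟩
  ∑ N (λ i → ∑ (N ∸ suc i) (G i)) + ∑ N (λ i → G i (N ∸ suc i))      ∎
  where
  split-row : ∀ i → i < N → ∑ (N ∸ i) (G i) ≡ ∑ (N ∸ suc i) (G i) + G i (N ∸ suc i)
  split-row i i<N = trans (cong (λ m → ∑ m (G i)) (suc-∸ i<N)) (∑-snoc (N ∸ suc i) (G i))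

∑-triangle : ∀ N (F : ℕ → ℕ → ℚ) →
  ∑ N (λ i → ∑ (N ∸ suc i) (λ j → F i j)) ≡ ∑ N (λ j → ∑ (N ∸ suc j) (λ i → F i j))
∑-triangle zero    F = refl
∑-triangle (suc N) F = begin
  ∑ (suc N) (λ i → ∑ (N ∸ i) (λ j → F i j))                                  ≡⟨ ∑-peel-antidiagonal N (λ i j → F i j) ⟩
  ∑ N (λ i → ∑ (N ∸ suc i) (λ j → F i j)) + ∑ N (λ i → F i (N ∸ suc i))      ≡⟨ cong₂ _+_ (∑-triangle N F) antidiagonal ⟩
  ∑ N (λ j → ∑ (N ∸ suc j) (λ i → F i j)) + ∑ N (λ j → F (N ∸ suc j) j)      ≡⟨ sym (∑-peel-antidiagonal N (λ j i → F i j)) ⟩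
  ∑ (suc N) (λ j → ∑ (N ∸ j) (λ i → F i j))                                  ∎
  where
  antidiagonal : ∑ N (λ i → F i (N ∸ suc i)) ≡ ∑ N (λ j → F (N ∸ suc j) j)
  antidiagonal = trans (∑-reverse N _)
    (∑-cong N (λ j j<N → cong (F (N ∸ suc j)) (reflect-index j<N)))

-- (f ⋆ g)(e) = Σ_{1 ≤ l ≤ e} f(l)·g(e − l); the value f 0 is never used.
infixr 7 _⋆_
_⋆_ : (ℕ → ℚ) → (ℕ → ℚ) → ℕ → ℚ
(f ⋆ g) e = ∑ e (λ i → f (suc i) * g (e ∸ suc i))

δ : ℕ → ℚ
δ zero    = 1ℚ
δ (suc _) = 0ℚ

deg-δ : ∀ v → deg δ v ≡ 0ℚ
deg-δ zero    = *-zeroˡ 1ℚ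
deg-δ (suc v) = *-zeroʳ (ι (suc v))

-- Congruence, scaling and vanishing of ⋆, pointwise (there is no funext).
⋆-congˡ : ∀ f f′ g → (∀ l → f (suc l) ≡ f′ (suc l)) → ∀ e → (f ⋆ g) e ≡ (f′ ⋆ g) e
⋆-congˡ f f′ g f≡f′ e = ∑-cong e (λ i _ → cong (_* g (e ∸ suc i)) (f≡f′ i))

⋆-congʳ : ∀ f g g′ → (∀ v → g v ≡ g′ v) → ∀ e → (f ⋆ g) e ≡ (f ⋆ g′) e
⋆-congʳ f g g′ g≡g′ e = ∑-cong e (λ i _ → cong (f (suc i) *_) (g≡g′ (e ∸ suc i)))

⋆-scaleʳ : ∀ f k g e → (f ⋆ (λ v → k * g v)) e ≡ k * (f ⋆ g) e
⋆-scaleʳ f k g e = trans (∑-cong e (λ i _ → *-leftComm (f (suc i)) k (g (e ∸ suc i)))) (∑-*ˡ e k _)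

⋆-zeroʳ : ∀ f g → (∀ v → g v ≡ 0ℚ) → ∀ e → (f ⋆ g) e ≡ 0ℚ
⋆-zeroʳ f g g≡0 e = ∑-zero e _ (λ i _ → trans (cong (f (suc i) *_) (g≡0 (e ∸ suc i))) (*-zeroʳ (f (suc i))))

⋆-unitʳ : ∀ f → f 0 ≡ 0ℚ → ∀ e → (f ⋆ δ) e ≡ f e
⋆-unitʳ f f0 zero    = sym f0
⋆-unitʳ f f0 (suc e) = begin
  ∑ (suc e) (λ i → f (suc i) * δ (e ∸ i))              ≡⟨ ∑-snoc e _ ⟩
  ∑ e (λ i → f (suc i) * δ (e ∸ i)) + f (suc e) * δ (e ∸ e)
    ≡⟨ cong₂ _+_ (∑-zero e _ (λ i i<e → trans (cong (λ t → f (suc i) * δ t) (suc-∸ i<e)) (*-zeroʳ (f (suc i)))))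
                 (cong (λ t → f (suc e) * δ t) (ℕP.n∸n≡0 e)) ⟩
  0ℚ + f (suc e) * 1ℚ                                   ≡⟨ trans (+-identityˡ _) (*-identityʳ _) ⟩
  f (suc e)                                             ∎

∸-swap : ∀ e a b → e ∸ a ∸ b ≡ e ∸ b ∸ a
∸-swap e a b = trans (ℕP.∸-+-assoc e a b) (trans (cong (e ∸_) (ℕP.+-comm a b)) (sym (ℕP.∸-+-assoc e b a)))

⋆-leftComm : ∀ f g h e → (f ⋆ (g ⋆ h)) e ≡ (g ⋆ (f ⋆ h)) e
⋆-leftComm f g h e = begin
  ∑ e (λ i → f (suc i) * ∑ (e ∸ suc i) (λ j → g (suc j) * h (e ∸ suc i ∸ suc j)))
    ≡⟨ ∑-cong e (λ i _ → sym (∑-*ˡ (e ∸ suc i) (f (suc i)) _)) ⟩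
  ∑ e (λ i → ∑ (e ∸ suc i) (λ j → F i j))
    ≡⟨ ∑-triangle e F ⟩
  ∑ e (λ j → ∑ (e ∸ suc j) (λ i → F i j))
    ≡⟨ ∑-cong e (λ j _ → trans (∑-cong (e ∸ suc j) (λ i _ → regroup i j)) (∑-*ˡ (e ∸ suc j) (g (suc j)) _)) ⟩
  ∑ e (λ j → g (suc j) * ∑ (e ∸ suc j) (λ i → f (suc i) * h (e ∸ suc j ∸ suc i)))
    ∎
  where
  F : ℕ → ℕ → ℚ
  F i j = f (suc i) * (g (suc j) * h (e ∸ suc i ∸ suc j))
  regroup : ∀ i j → F i j ≡ g (suc j) * (f (suc i) * h (e ∸ suc j ∸ suc i))
  regroup i j = trans (cong (λ t → f (suc i) * (g (suc j) * h t)) (∸-swap e (suc i) (suc j)))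
    (*-leftComm (f (suc i)) (g (suc j)) (h (e ∸ suc j ∸ suc i)))

-- Leibniz rule: the degree operator is a derivation for ⋆, since the
-- total e splits as l + (e − l) in every term.
⋆-leibniz : ∀ f g e → deg (f ⋆ g) e ≡ (deg f ⋆ g) e + (f ⋆ deg g) e
⋆-leibniz f g e = begin
  ι e * ∑ e (λ i → f (suc i) * g (e ∸ suc i))              ≡⟨ sym (∑-*ˡ e (ι e) _) ⟩
  ∑ e (λ i → ι e * (f (suc i) * g (e ∸ suc i)))            ≡⟨ ∑-cong e split-degree ⟩
  ∑ e (λ i → deg f (suc i) * g (e ∸ suc i) + f (suc i) * deg g (e ∸ suc i))
                                                            ≡⟨ ∑-+ e _ _ ⟩
  (deg f ⋆ g) e + (f ⋆ deg g) e                            ∎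
  where
  open ℚ-Solver using (solve; _:+_; _:*_; _:=_)
  distrib : ∀ a b x y → (a + b) * (x * y) ≡ (a * x) * y + x * (b * y)
  distrib = solve 4 (λ a b x y → (a :+ b) :* (x :* y) := (a :* x) :* y :+ x :* (b :* y)) refl
  split-degree : ∀ i → i < e →
    ι e * (f (suc i) * g (e ∸ suc i)) ≡ deg f (suc i) * g (e ∸ suc i) + f (suc i) * deg g (e ∸ suc i)
  split-degree i i<e = begin
    ι e * (f (suc i) * g (e ∸ suc i))
      ≡⟨ cong (λ t → ι t * (f (suc i) * g (e ∸ suc i))) (sym (ℕP.m+[n∸m]≡n i<e)) ⟩
    ι (suc i ℕ.+ (e ∸ suc i)) * (f (suc i) * g (e ∸ suc i))
      ≡⟨ cong (_* (f (suc i) * g (e ∸ suc i))) (ι-+ (suc i) (e ∸ suc i)) ⟩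
    (ι (suc i) + ι (e ∸ suc i)) * (f (suc i) * g (e ∸ suc i))
      ≡⟨ distrib (ι (suc i)) (ι (e ∸ suc i)) (f (suc i)) (g (e ∸ suc i)) ⟩
    deg f (suc i) * g (e ∸ suc i) + f (suc i) * deg g (e ∸ suc i)
      ∎

module WeightedChains (c : ℕ → ℚ) (c-zero : c 0 ≡ 0ℚ) where

  w : ℕ → ℚ
  w l = c l * recip l

  comp : ℕ → ℕ → ℚ
  comp zero    = δ
  comp (suc n) = w ⋆ comp n

  deg-w : ∀ l → deg w (suc l) ≡ c (suc l)
  deg-w l = begin
    ι (suc l) * (c (suc l) * recip (suc l))   ≡⟨ *-leftComm (ι (suc l)) (c (suc l)) (recip (suc l)) ⟩
    c (suc l) * (ι (suc l) * recip (suc l))   ≡⟨ cong (c (suc l) *_) (ι*recip l) ⟩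
    c (suc l) * 1ℚ                            ≡⟨ *-identityʳ (c (suc l)) ⟩
    c (suc l)                                 ∎

  -- By Leibniz the degree falls either on the first part (giving c) or on
  -- the remaining n parts, where induction and ⋆-leftComm give n·(c ⋆ comp n).
  comp-degree : ∀ n e → deg (comp (suc n)) e ≡ ι (suc n) * (c ⋆ comp n) e
  w⋆deg-comp  : ∀ n e → (w ⋆ deg (comp n)) e ≡ ι n * (c ⋆ comp n) e

  comp-degree n e = begin
    deg (w ⋆ comp n) e                             ≡⟨ ⋆-leibniz w (comp n) e ⟩
    (deg w ⋆ comp n) e + (w ⋆ deg (comp n)) e      ≡⟨ cong₂ _+_ (⋆-congˡ (deg w) c (comp n) deg-w e) (w⋆deg-comp n e) ⟩
    (c ⋆ comp n) e + ι n * (c ⋆ comp n) e          ≡⟨ ι-suc-* n _ ⟩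
    ι (suc n) * (c ⋆ comp n) e                     ∎

  w⋆deg-comp zero    e = trans (⋆-zeroʳ w (deg δ) deg-δ e) (sym (*-zeroˡ ((c ⋆ comp zero) e)))
  w⋆deg-comp (suc m) e = begin
    (w ⋆ deg (comp (suc m))) e                      ≡⟨ ⋆-congʳ w (deg (comp (suc m))) (λ v → ι (suc m) * (c ⋆ comp m) v) (comp-degree m) e ⟩
    (w ⋆ (λ v → ι (suc m) * (c ⋆ comp m) v)) e      ≡⟨ ⋆-scaleʳ w (ι (suc m)) (c ⋆ comp m) e ⟩
    ι (suc m) * (w ⋆ c ⋆ comp m) e                  ≡⟨ cong (ι (suc m) *_) (⋆-leftComm w c (comp m) e) ⟩
    ι (suc m) * (c ⋆ comp (suc m)) e                ∎

  -- chain k s e = Σ over s < u₁ < ⋯ < u_k < e of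
  --   c(u₁ − s)·c(u₂ − u₁)⋯c(e − u_k) / (u₁⋯u_k),
  -- by recursion on the smallest point u₁; points u ≤ s contribute
  -- nothing because c(u ∸ s) = c(0) = 0.
  chain : ℕ → ℕ → ℕ → ℚ
  chain zero    s e = c (e ∸ s)
  chain (suc k) s e = ∑ e (λ u → c (u ∸ s) * (recip u * chain k u e))

  chain-vanish : ∀ k {s e} → e ≤ s → chain k s e ≡ 0ℚ
  chain-vanish zero    e≤s = trans (cong c (ℕP.m≤n⇒m∸n≡0 e≤s)) c-zero
  chain-vanish (suc k) {s} {e} e≤s = ∑-zero e term (λ u u<e →
    trans (cong (λ t → c t * rest u) (ℕP.m≤n⇒m∸n≡0 (ℕP.<⇒≤ (ℕP.<-≤-trans u<e e≤s))))
          (trans (cong (_* rest u) c-zero) (*-zeroˡ (rest u))))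
    where
    rest : ℕ → ℚ
    rest u = recip u * chain k u e
    term : ℕ → ℚ
    term u = c (u ∸ s) * rest u

  -- The base case reverses the summation; the step swaps the two sums and
  -- truncates the inner one, whose extra terms vanish by chain-vanish.
  chain-last : ∀ k s e → chain (suc k) s e ≡ (c ⋆ (λ v → recip v * chain k s v)) e
  chain-last zero s e = trans (∑-reverse e _) (∑-cong e reflect)
    where
    reflect : ∀ i → i < e → c (e ∸ suc i ∸ s) * (recip (e ∸ suc i) * c (e ∸ (e ∸ suc i)))
                            ≡ c (suc i) * (recip (e ∸ suc i) * c (e ∸ suc i ∸ s))
    reflect i i<e = trans (cong (λ t → c (e ∸ suc i ∸ s) * (recip (e ∸ suc i) * c t)) (ℕP.m∸[m∸n]≡n i<e))
      (*-reverse3 (c (e ∸ suc i ∸ s)) (recip (e ∸ suc i)) (c (suc i)))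
  chain-last (suc k) s e = begin
    ∑ e (λ u → c (u ∸ s) * (recip u * chain (suc k) u e))
      ≡⟨ ∑-cong e (λ u _ → trans (sym (*-assoc (c (u ∸ s)) (recip u) _)) (cong (a u *_) (chain-last k u e))) ⟩
    ∑ e (λ u → a u * ∑ e (λ i → c (suc i) * (recip (e ∸ suc i) * chain k u (e ∸ suc i))))
      ≡⟨ ∑-cong e (λ u _ → trans (sym (∑-*ˡ e (a u) _)) (∑-cong e (λ i _ → regroup u i))) ⟩
    ∑ e (λ u → ∑ e (λ i → b i * (a u * chain k u (e ∸ suc i))))
      ≡⟨ ∑-comm e e _ ⟩
    ∑ e (λ i → ∑ e (λ u → b i * (a u * chain k u (e ∸ suc i))))
      ≡⟨ ∑-cong e (λ i i<e → trans (∑-*ˡ e (b i) _) (cong (b i *_) (truncate i i<e))) ⟩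
    ∑ e (λ i → b i * chain (suc k) s (e ∸ suc i))
      ≡⟨ ∑-cong e (λ i _ → *-assoc (c (suc i)) (recip (e ∸ suc i)) _) ⟩
    (c ⋆ (λ v → recip v * chain (suc k) s v)) e
      ∎
    where
    a : ℕ → ℚ
    a u = c (u ∸ s) * recip u
    b : ℕ → ℚ
    b i = c (suc i) * recip (e ∸ suc i)
    regroup : ∀ u i → a u * (c (suc i) * (recip (e ∸ suc i) * chain k u (e ∸ suc i)))
                      ≡ b i * (a u * chain k u (e ∸ suc i))
    regroup u i = begin
      a u * (c (suc i) * (recip (e ∸ suc i) * x))   ≡⟨ cong (a u *_) (sym (*-assoc (c (suc i)) (recip (e ∸ suc i)) x)) ⟩
      a u * (b i * x)                               ≡⟨ *-leftComm (a u) (b i) x ⟩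
      b i * (a u * x)                               ∎
      where x = chain k u (e ∸ suc i)
    truncate : ∀ i → i < e → ∑ e (λ u → a u * chain k u (e ∸ suc i)) ≡ chain (suc k) s (e ∸ suc i)
    truncate i i<e = begin
      ∑ e (λ u → a u * chain k u v)
        ≡⟨ cong (λ m → ∑ m (λ u → a u * chain k u v)) (sym (ℕP.m∸n+n≡m i<e)) ⟩
      ∑ (v ℕ.+ suc i) (λ u → a u * chain k u v)
        ≡⟨ ∑-vanishing-tail v (suc i) (λ u → a u * chain k u v)
             (λ j → trans (cong (a (v ℕ.+ j) *_) (chain-vanish k (ℕP.m≤m+n v j))) (*-zeroʳ (a (v ℕ.+ j)))) ⟩
      ∑ v (λ u → a u * chain k u v)
        ≡⟨ ∑-cong v (λ u _ → *-assoc (c (u ∸ s)) (recip u) (chain k u v)) ⟩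
      chain (suc k) s v
        ∎
      where v = e ∸ suc i

  -- Symmetrisation puts one factor c on the largest part; induction
  -- rewrites the remaining composition sum as a chain, and chain-last
  -- reassembles the longer chain.
  comp-chain : ∀ k e → deg (comp (suc k)) e ≡ ι (suc k !) * chain k 0 e
  comp-chain zero e = trans (comp-degree 0 e) (cong (ι 1 *_) (⋆-unitʳ c c-zero e))
  comp-chain (suc k) e = begin
    deg (comp (suc (suc k))) e
      ≡⟨ comp-degree (suc k) e ⟩
    ι (suc (suc k)) * (c ⋆ comp (suc k)) e
      ≡⟨ cong (ι (suc (suc k)) *_) (⋆-congʳ c (comp (suc k)) (λ v → F * (recip v * chain k 0 v)) by-induction e) ⟩
    ι (suc (suc k)) * (c ⋆ (λ v → F * (recip v * chain k 0 v))) e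
      ≡⟨ cong (ι (suc (suc k)) *_) (⋆-scaleʳ c F (λ v → recip v * chain k 0 v) e) ⟩
    ι (suc (suc k)) * (F * (c ⋆ (λ v → recip v * chain k 0 v)) e)
      ≡⟨ cong (λ t → ι (suc (suc k)) * (F * t)) (sym (chain-last k 0 e)) ⟩
    ι (suc (suc k)) * (F * chain (suc k) 0 e)
      ≡⟨ sym (*-assoc (ι (suc (suc k))) F _) ⟩
    (ι (suc (suc k)) * F) * chain (suc k) 0 e
      ≡⟨ cong (_* chain (suc k) 0 e) (sym (ι-* (suc (suc k)) (suc k !))) ⟩
    ι (suc (suc k) !) * chain (suc k) 0 e
      ∎
    where
    F : ℚ
    F = ι (suc k !)
    by-induction : ∀ v → comp (suc k) v ≡ F * (recip v * chain k 0 v)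
    by-induction v = begin
      comp (suc k) v                      ≡⟨ recip-deg (comp (suc k)) refl v ⟩
      recip v * deg (comp (suc k)) v      ≡⟨ cong (recip v *_) (comp-chain k v) ⟩
      recip v * (F * chain k 0 v)         ≡⟨ *-leftComm (recip v) F (chain k 0 v) ⟩
      F * (recip v * chain k 0 v)         ∎

recipProd : List ℕ → ℚ
recipProd = foldr (λ x r → recip x * r) 1ℚ

restrictedSum : {P : List ℕ → Set} → Decidable P → List (List ℕ) → ℚ
restrictedSum P? ts = sumRecipProd (filter P? ts)

module _ {P : List ℕ → Set} (P? : Decidable P) where

  restrictedSum-cons : ∀ t ts → restrictedSum P? (t ∷ ts) ≡ ind (does (P? t)) * recipProd t + restrictedSum P? ts
  restrictedSum-cons t ts with does (P? t)
  ... | true  = cong (_+ restrictedSum P? ts) (sym (*-identityˡ (recipProd t)))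
  ... | false = sym (trans (cong (_+ restrictedSum P? ts) (*-zeroˡ (recipProd t))) (+-identityˡ _))

  restrictedSum-++ : ∀ xs ys → restrictedSum P? (xs ++ ys) ≡ restrictedSum P? xs + restrictedSum P? ys
  restrictedSum-++ []       ys = sym (+-identityˡ _)
  restrictedSum-++ (x ∷ xs) ys = begin
    restrictedSum P? (x ∷ xs ++ ys)                            ≡⟨ restrictedSum-cons x (xs ++ ys) ⟩
    t + restrictedSum P? (xs ++ ys)                            ≡⟨ cong (t +_) (restrictedSum-++ xs ys) ⟩
    t + (restrictedSum P? xs + restrictedSum P? ys)            ≡⟨ sym (+-assoc t _ _) ⟩
    (t + restrictedSum P? xs) + restrictedSum P? ys            ≡⟨ cong (_+ restrictedSum P? ys) (sym (restrictedSum-cons x xs)) ⟩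
    restrictedSum P? (x ∷ xs) + restrictedSum P? ys            ∎
    where t = ind (does (P? x)) * recipProd x

  restrictedSum-concat-from : ∀ (g : ℕ → List (List ℕ)) a k →
    restrictedSum P? (concatMap g (from a k)) ≡ ∑ k (λ i → restrictedSum P? (g (a ℕ.+ i)))
  restrictedSum-concat-from g a zero    = refl
  restrictedSum-concat-from g a (suc k) = begin
    restrictedSum P? (g a ++ concatMap g (from (suc a) k))
      ≡⟨ restrictedSum-++ (g a) _ ⟩
    restrictedSum P? (g a) + restrictedSum P? (concatMap g (from (suc a) k))
      ≡⟨ cong₂ _+_ (cong (λ m → restrictedSum P? (g m)) (sym (ℕP.+-identityʳ a)))
                   (trans (restrictedSum-concat-from g (suc a) k)
                          (∑-cong k (λ i _ → cong (λ m → restrictedSum P? (g m)) (sym (ℕP.+-suc a i))))) ⟩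
    ∑ (suc k) (λ i → restrictedSum P? (g (a ℕ.+ i)))
      ∎

restrictedSum-prefix : ∀ {P Q : List ℕ → Set} (P? : Decidable P) (Q? : Decidable Q) u b →
  (∀ t → does (P? (u ∷ t)) ≡ b ∧ does (Q? t)) →
  ∀ ts → restrictedSum P? (map (u ∷_) ts) ≡ ind b * (recip u * restrictedSum Q? ts)
restrictedSum-prefix P? Q? u b qualifies []       = sym (trans (cong (ind b *_) (*-zeroʳ (recip u))) (*-zeroʳ (ind b)))
restrictedSum-prefix P? Q? u b qualifies (t ∷ ts) = begin
  restrictedSum P? ((u ∷ t) ∷ map (u ∷_) ts)
    ≡⟨ restrictedSum-cons P? (u ∷ t) _ ⟩
  ind (does (P? (u ∷ t))) * (recip u * recipProd t) + restrictedSum P? (map (u ∷_) ts)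
    ≡⟨ cong₂ _+_ (cong (_* (recip u * recipProd t)) (trans (cong ind (qualifies t)) (ind-∧ b (does (Q? t)))))
                 (restrictedSum-prefix P? Q? u b qualifies ts) ⟩
  (ind b * ind (does (Q? t))) * (recip u * recipProd t) + ind b * (recip u * restrictedSum Q? ts)
    ≡⟨ factor (ind b) (ind (does (Q? t))) (recip u) (recipProd t) (restrictedSum Q? ts) ⟩
  ind b * (recip u * (ind (does (Q? t)) * recipProd t + restrictedSum Q? ts))
    ≡⟨ cong (λ x → ind b * (recip u * x)) (sym (restrictedSum-cons Q? t ts)) ⟩
  ind b * (recip u * restrictedSum Q? (t ∷ ts))
    ∎
  where
  open ℚ-Solver using (solve; _:+_; _:*_; _:=_)
  factor : ∀ β q r x s → (β * q) * (r * x) + β * (r * s) ≡ β * (r * (q * x + s))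
  factor = solve 5 (λ β q r x s → (β :* q) :* (r :* x) :+ β :* (r :* s) := β :* (r :* (q :* x :+ s))) refl

restrictedSum-cong : ∀ {P Q : List ℕ → Set} (P? : Decidable P) (Q? : Decidable Q) →
  (∀ t → does (P? t) ≡ does (Q? t)) → ∀ ts → restrictedSum P? ts ≡ restrictedSum Q? ts
restrictedSum-cong P? Q? agree []       = refl
restrictedSum-cong P? Q? agree (t ∷ ts) = begin
  restrictedSum P? (t ∷ ts)                                  ≡⟨ restrictedSum-cons P? t ts ⟩
  ind (does (P? t)) * recipProd t + restrictedSum P? ts      ≡⟨ cong₂ (λ b x → ind b * recipProd t + x) (agree t) (restrictedSum-cong P? Q? agree ts) ⟩
  ind (does (Q? t)) * recipProd t + restrictedSum Q? ts      ≡⟨ sym (restrictedSum-cons Q? t ts) ⟩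
  restrictedSum Q? (t ∷ ts)                                  ∎

module _ (p : ℕ) where

  open WeightedChains (χ p) (χ-zero p)

  Z-comp : ∀ n N → Z n N p ≡ comp n N
  Z-comp zero    zero    = +-identityʳ 1ℚ
  Z-comp zero    (suc N) = refl
  Z-comp (suc n) N = begin
    restrictedSum P? (concatMap (λ l → map (l ∷_) (compositions n (N ∸ l))) (from 1 N))
      ≡⟨ restrictedSum-concat-from P? (λ l → map (l ∷_) (compositions n (N ∸ l))) 1 N ⟩
    ∑ N (λ i → restrictedSum P? (map (suc i ∷_) (compositions n (N ∸ suc i))))
      ≡⟨ ∑-cong N (λ i _ → restrictedSum-prefix P? P? (suc i) (does (inP? p (suc i))) (λ _ → refl) (compositions n (N ∸ suc i))) ⟩
    ∑ N (λ i → χ p (suc i) * (recip (suc i) * Z n (N ∸ suc i) p))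
      ≡⟨ ∑-cong N (λ i _ → trans (cong (λ x → χ p (suc i) * (recip (suc i) * x)) (Z-comp n (N ∸ suc i)))
                                 (sym (*-assoc (χ p (suc i)) (recip (suc i)) _))) ⟩
    comp (suc n) N
      ∎
    where
    P? = all? (inP? p)

  last-from : ℕ → List ℕ → ℕ
  last-from s []       = s
  last-from s (u ∷ us) = last-from u us

  GoodFrom : ℕ → List ℕ → Set
  GoodFrom s us = All (InP p) (gaps s us) × InP p (last-from s us)

  goodFrom? : ∀ s → Decidable (GoodFrom s)
  goodFrom? s us = all? (inP? p) (gaps s us) ×-dec inP? p (last-from s us)

  lastOr0-from : ∀ us → lastOr0 us ≡ last-from 0 us
  lastOr0-from []           = refl
  lastOr0-from (u ∷ [])     = refl
  lastOr0-from (u ∷ v ∷ us) = lastOr0-from (v ∷ us)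

  chainSum : ℕ → ℕ → ℕ → ℚ
  chainSum k s N = restrictedSum (goodFrom? s) (incSeqs k (suc s) N)

  chainSum-zero : ∀ s N → chainSum zero s N ≡ χ p s
  chainSum-zero s N = trans (restrictedSum-cons (goodFrom? s) [] []) (trans (+-identityʳ _) (*-identityʳ _))

  chainSum-suc : ∀ k s N → chainSum (suc k) s N ≡
    ∑ (N ∸ suc s) (λ i → χ p (suc s ℕ.+ i ∸ s) * (recip (suc s ℕ.+ i) * chainSum k (suc s ℕ.+ i) N))
  chainSum-suc k s N = trans (restrictedSum-concat-from (goodFrom? s) tuplesFrom (suc s) (N ∸ suc s))
    (∑-cong (N ∸ suc s) (λ i _ → restrictedSum-prefix (goodFrom? s) (goodFrom? (suc s ℕ.+ i)) (suc s ℕ.+ i)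
      (does (inP? p (suc s ℕ.+ i ∸ s)))
      (λ t → ∧-assoc (does (inP? p (suc s ℕ.+ i ∸ s))) (does (all? (inP? p) (gaps (suc s ℕ.+ i) t)))
                     (does (inP? p (last-from (suc s ℕ.+ i) t)))) (incSeqs k (suc (suc s ℕ.+ i)) N)))
    where
    tuplesFrom : ℕ → List (List ℕ)
    tuplesFrom u = map (u ∷_) (incSeqs k (suc u) N)

  index-bound : ∀ m N i → i < N ∸ m → m ℕ.+ i < N
  index-bound zero    N       i i<N   = i<N
  index-bound (suc m) zero    i ()
  index-bound (suc m) (suc N) i i<N∸m = s≤s (index-bound m N i i<N∸m)

  chainSum-chain : ∀ {N} → p ∣ N → ∀ k s → s ≤ N → chainSum k s N ≡ chain k s N
  chainSum-chain {N} p∣N zero s s≤N = trans (chainSum-zero s N) (χ-complement p p∣N s≤N)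
  chainSum-chain {N} p∣N (suc k) s s≤N = begin
    chainSum (suc k) s N
      ≡⟨ chainSum-suc k s N ⟩
    ∑ (N ∸ suc s) (λ i → χ p (suc s ℕ.+ i ∸ s) * (recip (suc s ℕ.+ i) * chainSum k (suc s ℕ.+ i) N))
      ≡⟨ ∑-cong (N ∸ suc s) (λ i i<N∸s → cong (λ x → χ p (suc s ℕ.+ i ∸ s) * (recip (suc s ℕ.+ i) * x))
           (chainSum-chain p∣N k (suc s ℕ.+ i) (ℕP.<⇒≤ (index-bound (suc s) N i i<N∸s)))) ⟩
    ∑ (N ∸ suc s) (λ i → χ p (suc s ℕ.+ i ∸ s) * (recip (suc s ℕ.+ i) * chain k (suc s ℕ.+ i) N))
      ≡⟨ sym (∑-vanishing-prefix (suc s) N _ below-s) ⟩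
    chain (suc k) s N
      ∎
    where
    below-s : ∀ u → u < suc s → χ p (u ∸ s) * (recip u * chain k u N) ≡ 0ℚ
    below-s u (s≤s u≤s) = trans (cong (λ t → χ p t * rest) (ℕP.m≤n⇒m∸n≡0 u≤s)) (trans (cong (_* rest) (χ-zero p)) (*-zeroˡ rest))
      where rest = recip u * chain k u N

  RHS-chain : ∀ {N} → p ∣ N → ∀ k → sumRecipProd (filter (good? p) (incSeqs k 1 N)) ≡ chain k 0 N
  RHS-chain {N} p∣N k = trans
    (restrictedSum-cong (good? p) (goodFrom? 0)
      (λ us → cong (λ m → does (all? (inP? p) (gaps 0 us) ×-dec inP? p m)) (lastOr0-from us)) (incSeqs k 1 N))
    (chainSum-chain p∣N k 0 z≤n)

lemma2p1 : (n N p : ℕ) → 1 ≤ n → 1 ≤ N → Prime p → p ∣ N →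
    Z n N p ≡ RHS n N p
lemma2p1 (suc k) N p _ _ _ p∣N = begin
  Z (suc k) N p                                   ≡⟨ Z-comp p (suc k) N ⟩
  comp (suc k) N                                  ≡⟨ recip-deg (comp (suc k)) refl N ⟩
  recip N * deg (comp (suc k)) N                  ≡⟨ cong (recip N *_) (comp-chain k N) ⟩
  recip N * (ι (suc k !) * chain k 0 N)           ≡⟨ *-leftComm-assoc (recip N) (ι (suc k !)) (chain k 0 N) ⟩
  ι (suc k !) * recip N * chain k 0 N             ≡⟨ cong (ι (suc k !) * recip N *_) (sym (RHS-chain p p∣N k)) ⟩
  RHS (suc k) N p                                 ∎
  where open WeightedChains (χ p) (χ-zero p)
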